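{- For any odd integer $b\ge 3$ there is a transitive avoidance game on $2b$ points that is a Player I win.
   Context: An avoidance game consists of a finite set $X$ (the board) and a family $\mathcal{L}$ of subsets of $X$ (the lines). Two players, Player I and Player II, alternately claim previously unclaimed points of $X$, Player I moving first. The first player to have claimed all points of some line loses; if all points have been claimed and neither player has completed a line, the game is a draw. The game is transitive if its automorphism group (the group of permutations of $X$ mapping $\mathcal{L}$ onto $\mathcal{L}$) acts transitively on $X$. The game is a Player I win if Player I has a strategy guaranteeing that Player II loses. -}

module Defs where

open import Data.Nat using (ℕ)
open import Data.Fin using (Fin)
open import Data.Fin.Subset using (Subset; _∈_; _∉_; _⊆_; _∪_; ⁅_⁆)
open import Data.Fin.Permutation using (Permutation′; _⟨$⟩ʳ_; _⟨$⟩ˡ_)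
open import Data.Vec using (tabulate; lookup)
open import Data.List using (List)
import Data.List.Membership.Propositional as ListMem
open import Data.Product using (Σ; ∃; _×_)
open import Data.Sum using (_⊎_)
open import Relation.Binary.PropositionalEquality using (_≡_)
open import Relation.Nullary using (¬_)
open import Data.Fin.Subset using (⊥)

Lines : ℕ → Set
Lines n = List (Subset n)

image : {n : ℕ} → Permutation′ n → Subset n → Subset n
image σ ℓ = tabulate (λ y → lookup ℓ (σ ⟨$⟩ˡ y))

IsAutomorphism : {n : ℕ} → Lines n → Permutation′ n → Set
IsAutomorphism {n} ℒ σ =
  ((ℓ : Subset n) → ℓ ListMem.∈ ℒ → image σ ℓ ListMem.∈ ℒ) ×
  ((ℓ : Subset n) → ℓ ListMem.∈ ℒ → Σ (Subset n) (λ ℓ′ → ℓ′ ListMem.∈ ℒ × image σ ℓ′ ≡ ℓ))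

Transitive : {n : ℕ} → Lines n → Set
Transitive {n} ℒ = (x y : Fin n) →
  Σ (Permutation′ n) (λ σ → IsAutomorphism ℒ σ × σ ⟨$⟩ʳ x ≡ y)

CompletesLine : {n : ℕ} → Lines n → Subset n → Set
CompletesLine {n} ℒ S = Σ (Subset n) (λ ℓ → ℓ ListMem.∈ ℒ × ℓ ⊆ S)

-- Game positions: A = points claimed by Player I, B = points claimed by Player II.
-- WinI-IIToMove ℒ A B : with Player II to move, Player I can force that Player II loses.
-- (In a finite game, these inductive predicates are exactly the existence of a
-- winning strategy for Player I from the given position.)
mutual
  data WinI-toMove {n : ℕ} (ℒ : Lines n) (A B : Subset n) : Set where
    move : (x : Fin n) → x ∉ A → x ∉ B →
           ¬ CompletesLine ℒ (⁅ x ⁆ ∪ A) →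
           WinI-IIToMove ℒ (⁅ x ⁆ ∪ A) B →
           WinI-toMove ℒ A B

  data WinI-IIToMove {n : ℕ} (ℒ : Lines n) (A B : Subset n) : Set where
    replies : (Σ (Fin n) (λ y → y ∉ A × y ∉ B)) →
              ((y : Fin n) → y ∉ A → y ∉ B →
                 CompletesLine ℒ (⁅ y ⁆ ∪ B) ⊎ WinI-toMove ℒ A (⁅ y ⁆ ∪ B)) →
              WinI-IIToMove ℒ A B


PlayerIWin : {n : ℕ} → Lines n → Set
PlayerIWin ℒ = WinI-toMove ℒ ⊥ ⊥

-- Write b = 2m+1 and split the board into b pairs {(false, i), (true, i)}, indexed by the vertices i of
-- the rotational tournament on ℤ/b (e beats f iff e - f ∈ {1, …, m}).  The lines are
--   * the transversals (one point of every pair) with an even number of points on side true, and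
--   * for every e beating f, the sets holding all of pair f, nothing of pair e and one point of every
--     other pair.
-- Rotations of ℤ/b, combined with swapping the two sides of an even number of pairs, preserve the lines
-- and act transitively on the board, so the game is transitive.
-- Player I keeps every pair settled (free, or split between the players) except for a few special pairs:
-- he opens a pair h that beats a free pair r; if Player II takes the rest of h, Player I opens anew; if
-- Player II enters a free pair beaten by h, Player I fills h; otherwise Player I answers in the pair that
-- Player II entered.  Player I's set never contains a line, since it misses a pair beaten by the only pair
-- it fills.  When the free pairs run out, Player II has to fill a pair beaten by h, completing a tournament
-- line, or to complete the transversal complementary to Player I's, which Player I has made odd, so that
-- Player II's is even (b being odd).
module Submission where

open import Defs
open import Data.Nat using (ℕ; _*_; _%_; _≤_)
open import Data.Product using (Σ; _×_)
open import Relation.Binary.PropositionalEquality using (_≡_)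

open import Algebra.Bundles using (CommutativeRing)
import Algebra.Properties.CommutativeMonoid.Sum as CommutativeMonoidSum
open import Data.Bool using (Bool; true; false; not; _xor_; _∨_; if_then_else_)
open import Data.Bool.Properties
  using (xor-∧-commutativeRing; xor-comm; xor-assoc; xor-same; xor-identityʳ; xor-inverseˡ; true-xor; not-involutive)
  renaming (_≟_ to _≟ᵇ_)
open import Data.Empty using (⊥; ⊥-elim)
open import Data.Fin using (Fin; zero; suc; toℕ; fromℕ; inject₁; punchIn)
open import Data.Fin.Permutation using (Permutation′; permutation; _⟨$⟩ʳ_; _⟨$⟩ˡ_; inverseʳ; flip; _∘ₚ_)
import Data.Fin.Permutation as Permutation
open import Data.Fin.Properties
  using (_≟_; toℕ-fromℕ; toℕ-inject₁; toℕ-injective; toℕ<n; punchInᵢ≢i; 2↔Bool; *↔×; all?; any?)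
open import Data.Fin.Subset using (Subset; _∈_; _∉_; _⊆_; _⊂_; _∪_; ⁅_⁆; ∁; ∣_∣) renaming (⊥ to ∅)
open import Data.Fin.Subset.Properties
  using (x∈⁅x⁆; x∈⁅y⁆⇒x≡y; x∈p∪q⁻; p⊆p∪q; q⊆p∪q; p⊂q⇒∁p⊃∁q; p⊂q⇒∣p∣<∣q∣; ∉⊥; ∣⊥∣≡0; x∉p⇒x∈∁p)
open import Data.List using (List; []; _∷_; map; _++_; filter)
import Data.List.Membership.Propositional as ListMembership
open import Data.List.Membership.Propositional.Properties using (∈-filter⁺; ∈-filter⁻; ∈-map⁺; ∈-++⁺ˡ; ∈-++⁺ʳ)
open import Data.List.Relation.Unary.Any using (here)
open import Data.Nat using (zero; suc; _+_; _<_; _<?_; _≤?_; s≤s; z≤n)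
open import Data.Nat.Properties
  using (<-asym; <⇒≱; ≰⇒>; <-cmp; +-monoˡ-≤; +-monoˡ-<; +-cancelʳ-≤; +-cancelʳ-<; +-suc; suc-injective;
         ≤-refl; <⇒≤; ≤-pred; <-≤-trans; n≮0)
open import Data.Product using (_,_; proj₁; proj₂)
open import Data.Product.Function.NonDependent.Propositional using (_×-↔_)
open import Data.Product.Properties using (≡-dec)
open import Data.Sum using (_⊎_; inj₁; inj₂; [_,_])
open import Data.Vec using ([]; _∷_; lookup)
open import Data.Vec.Properties
  using ([]=⇒lookup; lookup⇒[]=; lookup-zipWith; lookup-replicate; lookup∘tabulate; tabulate∘lookup; tabulate-cong)
open import Function using (_∘_)
open import Function.Bundles using (_↔_; Inverse)
open import Function.Construct.Composition using (_↔-∘_)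
open import Function.Construct.Identity using (↔-id)
open import Relation.Binary using (tri<; tri≈; tri>)
open import Relation.Binary.Definitions using (DecidableEquality)
open import Relation.Binary.PropositionalEquality
  using (refl; sym; trans; cong; cong₂; subst; subst₂; _≢_; ≢-sym; module ≡-Reasoning)
open import Relation.Nullary using (¬_; Dec; yes; no; does)
open import Relation.Nullary.Decidable using (_×-dec_; _⊎-dec_; _→-dec_; ¬?)

module XorSum = CommutativeMonoidSum (CommutativeRing.+-commutativeMonoid xor-∧-commutativeRing)

parity : ∀ {n} → (Fin n → Bool) → Bool
parity = XorSum.sum

parity-cong : ∀ {n} {f g : Fin n → Bool} → (∀ i → f i ≡ g i) → parity f ≡ parity g
parity-cong = XorSum.sum-cong-≗

parity-xor : ∀ {n} (f g : Fin n → Bool) → parity (λ i → f i xor g i) ≡ parity f xor parity g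
parity-xor = XorSum.∑-distrib-+

parity-permute : ∀ {n} (f : Fin n → Bool) (π : Permutation′ n) → parity (λ i → f (π ⟨$⟩ʳ i)) ≡ parity f
parity-permute f π = sym (XorSum.∑-permute f π)

parity-set : ∀ {n} (f g : Fin n → Bool) (x : Fin n) → f x ≡ false →
             (∀ y → y ≢ x → g y ≡ f y) → parity g ≡ g x xor parity f
parity-set {suc n} f g x fx≡false same-elsewhere = begin
  parity g                                     ≡⟨ XorSum.sum-remove {i = x} g ⟩
  g x xor parity (g ∘ punchIn x)               ≡⟨ cong (g x xor_) (parity-cong (λ k → same-elsewhere _ (punchInᵢ≢i x k))) ⟩
  g x xor parity (f ∘ punchIn x)               ≡⟨ cong (λ v → g x xor (v xor parity (f ∘ punchIn x))) fx≡false ⟨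
  g x xor (f x xor parity (f ∘ punchIn x))     ≡⟨ cong (g x xor_) (XorSum.sum-remove {i = x} f) ⟨
  g x xor parity f                             ∎
  where open ≡-Reasoning

parity-zero : ∀ n → parity {n} (λ _ → false) ≡ false
parity-zero n = XorSum.sum-replicate-zero n

indicator : ∀ {n} → Fin n → Fin n → Bool
indicator x y = does (x ≟ y)

parity-indicator : ∀ {n} (x : Fin n) → parity (indicator x) ≡ true
parity-indicator {n} x = trans (parity-set (λ _ → false) (indicator x) x refl off-x)
                               (cong₂ _xor_ on-x (parity-zero n))
  where
  on-x : indicator x x ≡ true
  on-x with x ≟ x
  ... | yes _ = refl
  ... | no x≢x = ⊥-elim (x≢x refl)
  off-x : ∀ y → y ≢ x → indicator x y ≡ false
  off-x y y≢x with x ≟ y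
  ... | yes x≡y = ⊥-elim (y≢x (sym x≡y))
  ... | no _ = refl

parity-all-true : ∀ m → parity {suc (m + m)} (λ _ → true) ≡ true
parity-all-true zero = refl
parity-all-true (suc m) rewrite +-suc m m = trans (not-involutive (parity {suc (m + m)} (λ _ → true))) (parity-all-true m)

parity-complement : ∀ m (f : Fin (suc (m + m)) → Bool) → parity (λ i → not (f i)) ≡ not (parity f)
parity-complement m f = begin
  parity (λ i → not (f i))              ≡⟨ parity-cong (λ i → trans (sym (true-xor (f i))) (xor-comm true (f i))) ⟩
  parity (λ i → f i xor true)           ≡⟨ parity-xor f (λ _ → true) ⟩
  parity f xor parity {suc (m + m)} (λ _ → true)  ≡⟨ cong (parity f xor_) (parity-all-true m) ⟩
  parity f xor true                     ≡⟨ trans (xor-comm (parity f) true) (true-xor (parity f)) ⟩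
  not (parity f)                        ∎
  where open ≡-Reasoning

rotate : ∀ {n} → Fin (suc n) → Fin (suc n)
rotate {n} zero = fromℕ n
rotate (suc i) = inject₁ i

rotate⁻¹ : ∀ {n} → Fin (suc n) → Fin (suc n)
rotate⁻¹ {zero} zero = zero
rotate⁻¹ {suc n} zero = suc zero
rotate⁻¹ {suc n} (suc i) = lift (rotate⁻¹ i)
  where
  lift : Fin (suc n) → Fin (suc (suc n))
  lift zero = zero
  lift (suc j) = suc (suc j)

rotate⁻¹-fromℕ : ∀ n → rotate⁻¹ (fromℕ n) ≡ zero
rotate⁻¹-fromℕ zero = refl
rotate⁻¹-fromℕ (suc n) rewrite rotate⁻¹-fromℕ n = refl

rotate⁻¹-inject₁ : ∀ {n} (i : Fin n) → rotate⁻¹ (inject₁ i) ≡ suc i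
rotate⁻¹-inject₁ {suc n} zero = refl
rotate⁻¹-inject₁ {suc n} (suc i) rewrite rotate⁻¹-inject₁ i = refl

rotate⁻¹-rotate : ∀ {n} (i : Fin (suc n)) → rotate⁻¹ (rotate i) ≡ i
rotate⁻¹-rotate {n} zero = rotate⁻¹-fromℕ n
rotate⁻¹-rotate (suc i) = rotate⁻¹-inject₁ i

rotate-rotate⁻¹ : ∀ {n} (i : Fin (suc n)) → rotate (rotate⁻¹ i) ≡ i
rotate-rotate⁻¹ {zero} zero = refl
rotate-rotate⁻¹ {suc n} zero = refl
rotate-rotate⁻¹ {suc n} (suc i) with rotate⁻¹ i | rotate-rotate⁻¹ i
... | zero  | eq = cong suc eq
... | suc j | eq = cong suc eq

rotate-moves : ∀ {n} (i : Fin (suc (suc n))) → rotate i ≢ i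
rotate-moves zero ()
rotate-moves (suc i) eq = no-fixpoint (toℕ i) (trans (sym (toℕ-inject₁ i)) (cong toℕ eq))
  where
  no-fixpoint : ∀ k → k ≢ suc k
  no-fixpoint zero ()
  no-fixpoint (suc k) e = no-fixpoint k (suc-injective e)

-- The rotational tournament on ℤ/(2m+1): a beats c iff a - c ∈ {1, …, m} (mod 2m+1),
-- stated for representatives a, c < 2m+1.
module Tournament (m : ℕ) where

  Beats : ℕ → ℕ → Set
  Beats a c = (c < a × a ≤ c + m) ⊎ (a < c × a + m < c)

  Beats? : ∀ a c → Dec (Beats a c)
  Beats? a c = ((c <? a) ×-dec (a ≤? c + m)) ⊎-dec ((a <? c) ×-dec (a + m <? c))

  Beats-asym : ∀ {a c} → Beats a c → Beats c a → ⊥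
  Beats-asym (inj₁ (c<a , _)) (inj₁ (a<c , _)) = <-asym c<a a<c
  Beats-asym (inj₁ (_ , a≤c+m)) (inj₂ (_ , c+m<a)) = <⇒≱ c+m<a a≤c+m
  Beats-asym (inj₂ (_ , a+m<c)) (inj₁ (_ , c≤a+m)) = <⇒≱ a+m<c c≤a+m
  Beats-asym (inj₂ (a<c , _)) (inj₂ (c<a , _)) = <-asym c<a a<c

  Beats-total : ∀ a c → a ≢ c → Beats a c ⊎ Beats c a
  Beats-total a c a≢c with <-cmp a c
  ... | tri≈ _ a≡c _ = ⊥-elim (a≢c a≡c)
  ... | tri< a<c _ _ with c ≤? a + m
  ...   | yes c≤a+m = inj₂ (inj₁ (a<c , c≤a+m))
  ...   | no c≰a+m = inj₁ (inj₂ (a<c , ≰⇒> c≰a+m))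
  Beats-total a c a≢c | tri> _ _ c<a with a ≤? c + m
  ...   | yes a≤c+m = inj₁ (inj₁ (c<a , a≤c+m))
  ...   | no a≰c+m = inj₂ (inj₂ (c<a , ≰⇒> a≰c+m))

  Beats-pred : ∀ {a c} → Beats (suc a) (suc c) → Beats a c
  Beats-pred (inj₁ (s≤s c<a , s≤s a≤c+m)) = inj₁ (c<a , a≤c+m)
  Beats-pred (inj₂ (s≤s a<c , s≤s a+m<c)) = inj₂ (a<c , a+m<c)

  Beats-suc : ∀ {a c} → Beats a c → Beats (suc a) (suc c)
  Beats-suc (inj₁ (c<a , a≤c+m)) = inj₁ (s≤s c<a , s≤s a≤c+m)
  Beats-suc (inj₂ (a<c , a+m<c)) = inj₂ (s≤s a<c , s≤s a+m<c)

  Beats-wrapˡ : ∀ {c} → c < m + m → Beats 0 (suc c) → Beats (m + m) c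
  Beats-wrapˡ _ (inj₁ (() , _))
  Beats-wrapˡ c<2m (inj₂ (_ , s≤s m≤c)) = inj₁ (c<2m , +-monoˡ-≤ m m≤c)

  Beats-wrapˡ⁻ : ∀ {c} → c < m + m → Beats (m + m) c → Beats 0 (suc c)
  Beats-wrapˡ⁻ {c} _ (inj₁ (_ , 2m≤c+m)) = inj₂ (s≤s z≤n , s≤s (+-cancelʳ-≤ m m c 2m≤c+m))
  Beats-wrapˡ⁻ c<2m (inj₂ (2m<c , _)) = ⊥-elim (<-asym 2m<c c<2m)

  Beats-wrapʳ : ∀ {a} → a < m + m → Beats (suc a) 0 → Beats a (m + m)
  Beats-wrapʳ a<2m (inj₁ (_ , a<m)) = inj₂ (a<2m , +-monoˡ-< m a<m)
  Beats-wrapʳ _ (inj₂ (_ , ()))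

  Beats-wrapʳ⁻ : ∀ {a} → a < m + m → Beats a (m + m) → Beats (suc a) 0
  Beats-wrapʳ⁻ a<2m (inj₁ (2m<a , _)) = ⊥-elim (<-asym 2m<a a<2m)
  Beats-wrapʳ⁻ {a} _ (inj₂ (_ , a+m<2m)) = inj₁ (s≤s z≤n , +-cancelʳ-< m a m a+m<2m)

  b : ℕ
  b = suc (m + m)

  beats : Fin b → Fin b → Set
  beats e f = Beats (toℕ e) (toℕ f)

  beats? : ∀ e f → Dec (beats e f)
  beats? e f = Beats? (toℕ e) (toℕ f)

  beats-asym : ∀ {e f} → beats e f → beats f e → ⊥
  beats-asym = Beats-asym

  beats-irrefl : ∀ {e} → beats e e → ⊥
  beats-irrefl e→e = Beats-asym e→e e→e

  beats-total : ∀ e f → e ≢ f → beats e f ⊎ beats f e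
  beats-total e f e≢f = Beats-total (toℕ e) (toℕ f) (e≢f ∘ toℕ-injective)

  beats-rotate : ∀ {e f} → beats e f → beats (rotate e) (rotate f)
  beats-rotate {zero} {zero} e→f = ⊥-elim (beats-irrefl {zero} e→f)
  beats-rotate {zero} {suc f} e→f rewrite toℕ-fromℕ (m + m) | toℕ-inject₁ f = Beats-wrapˡ (toℕ<n f) e→f
  beats-rotate {suc e} {zero} e→f rewrite toℕ-fromℕ (m + m) | toℕ-inject₁ e = Beats-wrapʳ (toℕ<n e) e→f
  beats-rotate {suc e} {suc f} e→f rewrite toℕ-inject₁ e | toℕ-inject₁ f = Beats-pred e→f

  beats-rotate⁻ : ∀ {e f} → beats (rotate e) (rotate f) → beats e f
  beats-rotate⁻ {zero} {zero} e→f = ⊥-elim (beats-irrefl {rotate {m + m} zero} e→f)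
  beats-rotate⁻ {zero} {suc f} e→f rewrite toℕ-fromℕ (m + m) | toℕ-inject₁ f = Beats-wrapˡ⁻ (toℕ<n f) e→f
  beats-rotate⁻ {suc e} {zero} e→f rewrite toℕ-fromℕ (m + m) | toℕ-inject₁ e = Beats-wrapʳ⁻ (toℕ<n e) e→f
  beats-rotate⁻ {suc e} {suc f} e→f rewrite toℕ-inject₁ e | toℕ-inject₁ f = Beats-suc e→f

  record Symmetry : Set where
    field
      perm : Permutation′ b
      preserves : ∀ {e f} → beats e f → beats (perm ⟨$⟩ʳ e) (perm ⟨$⟩ʳ f)
      reflects : ∀ {e f} → beats (perm ⟨$⟩ʳ e) (perm ⟨$⟩ʳ f) → beats e f

  open Symmetry

  identity : Symmetry
  identity = record { perm = Permutation.id ; preserves = λ e→f → e→f ; reflects = λ e→f → e→f }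

  _then_ : Symmetry → Symmetry → Symmetry
  Q then R = record
    { perm = perm Q ∘ₚ perm R
    ; preserves = λ e→f → preserves R (preserves Q e→f)
    ; reflects = λ e→f → reflects Q (reflects R e→f) }

  inverse : Symmetry → Symmetry
  inverse Q = record
    { perm = flip (perm Q)
    ; preserves = λ e→f → reflects Q (subst₂ beats (sym (inverseʳ (perm Q))) (sym (inverseʳ (perm Q))) e→f)
    ; reflects = λ e→f → subst₂ beats (inverseʳ (perm Q)) (inverseʳ (perm Q)) (preserves Q e→f) }

  rotation : Symmetry
  rotation = record
    { perm = permutation rotate rotate⁻¹ rotate-rotate⁻¹ rotate⁻¹-rotate
    ; preserves = beats-rotate
    ; reflects = beats-rotate⁻ }

  rotation^ : ℕ → Symmetry
  rotation^ zero = identity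
  rotation^ (suc k) = rotation then rotation^ k

  rotation^-to-zero : ∀ k (i : Fin b) → toℕ i ≡ k → perm (rotation^ k) ⟨$⟩ʳ i ≡ zero
  rotation^-to-zero zero zero _ = refl
  rotation^-to-zero (suc k) (suc i) i≡k =
    rotation^-to-zero k (inject₁ i) (trans (toℕ-inject₁ i) (suc-injective i≡k))

  symmetry-between : ∀ i j → Σ Symmetry (λ Q → perm Q ⟨$⟩ʳ i ≡ j)
  symmetry-between i j = (rotation^ (toℕ i) then inverse (rotation^ (toℕ j))) , (begin
    Ρⱼ ⟨$⟩ˡ (Ρᵢ ⟨$⟩ʳ i)    ≡⟨ cong (Ρⱼ ⟨$⟩ˡ_) (rotation^-to-zero (toℕ i) i refl) ⟩
    Ρⱼ ⟨$⟩ˡ zero           ≡⟨ cong (Ρⱼ ⟨$⟩ˡ_) (rotation^-to-zero (toℕ j) j refl) ⟨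
    Ρⱼ ⟨$⟩ˡ (Ρⱼ ⟨$⟩ʳ j)    ≡⟨ Permutation.inverseˡ Ρⱼ ⟩
    j                      ∎)
    where
    open ≡-Reasoning
    Ρᵢ = perm (rotation^ (toℕ i))
    Ρⱼ = perm (rotation^ (toℕ j))

module _ {n : ℕ} where

  ∉⇒false : ∀ {x : Fin n} {S : Subset n} → x ∉ S → lookup S x ≡ false
  ∉⇒false {x} {S} x∉S with lookup S x in eq
  ... | true = ⊥-elim (x∉S (lookup⇒[]= x S eq))
  ... | false = refl

  false⇒∉ : ∀ {x : Fin n} {S : Subset n} → lookup S x ≡ false → x ∉ S
  false⇒∉ Sx≡false x∈S with trans (sym ([]=⇒lookup x∈S)) Sx≡false
  ... | ()

  lookup-⁅⁆-other : ∀ (x y : Fin n) → x ≢ y → lookup ⁅ x ⁆ y ≡ false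
  lookup-⁅⁆-other x y x≢y with lookup ⁅ x ⁆ y in eq
  ... | true = ⊥-elim (x≢y (sym (x∈⁅y⁆⇒x≡y x (lookup⇒[]= y ⁅ x ⁆ eq))))
  ... | false = refl

  lookup-add-here : ∀ (x : Fin n) (S : Subset n) → lookup (⁅ x ⁆ ∪ S) x ≡ true
  lookup-add-here x S = trans (lookup-zipWith _ x ⁅ x ⁆ S) (cong (_∨ lookup S x) ([]=⇒lookup (x∈⁅x⁆ x)))

  lookup-add-elsewhere : ∀ (x y : Fin n) (S : Subset n) → x ≢ y → lookup (⁅ x ⁆ ∪ S) y ≡ lookup S y
  lookup-add-elsewhere x y S x≢y = trans (lookup-zipWith _ y ⁅ x ⁆ S) (cong (_∨ lookup S y) (lookup-⁅⁆-other x y x≢y))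

  ∪-⊂ : ∀ {A B A′ B′ : Subset n} {x} → A ⊆ A′ → B ⊆ B′ → x ∈ A′ ∪ B′ → x ∉ A → x ∉ B → A ∪ B ⊂ A′ ∪ B′
  ∪-⊂ {A} {B} {A′} {B′} {x} A⊆A′ B⊆B′ x∈′ x∉A x∉B = grow , x , x∈′ , x∉A∪B
    where
    grow : A ∪ B ⊆ A′ ∪ B′
    grow y∈ with x∈p∪q⁻ A B y∈
    ... | inj₁ y∈A = p⊆p∪q B′ (A⊆A′ y∈A)
    ... | inj₂ y∈B = q⊆p∪q A′ B′ (B⊆B′ y∈B)
    x∉A∪B : x ∉ A ∪ B
    x∉A∪B x∈ with x∈p∪q⁻ A B x∈
    ... | inj₁ x∈A = x∉A x∈A
    ... | inj₂ x∈B = x∉B x∈B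

  Budget : Subset n → Subset n → ℕ → Set
  Budget A B k = ∣ ∁ (A ∪ B) ∣ ≤ k

  unclaimed-decreases : ∀ {A B A′ B′ : Subset n} → A ∪ B ⊂ A′ ∪ B′ → ∣ ∁ (A′ ∪ B′) ∣ < ∣ ∁ (A ∪ B) ∣
  unclaimed-decreases grow = p⊂q⇒∣p∣<∣q∣ (p⊂q⇒∁p⊃∁q grow)

  budget-claimI : ∀ {A B : Subset n} {x k} → x ∉ A → x ∉ B → Budget A B (suc k) → Budget (⁅ x ⁆ ∪ A) B k
  budget-claimI {A} x∉A x∉B bound =
    ≤-pred (<-≤-trans (unclaimed-decreases (∪-⊂ (q⊆p∪q _ A) (λ y∈ → y∈) (p⊆p∪q _ (p⊆p∪q A (x∈⁅x⁆ _))) x∉A x∉B)) bound)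

  budget-claimII : ∀ {A B : Subset n} {x k} → x ∉ A → x ∉ B → Budget A B k → Budget A (⁅ x ⁆ ∪ B) k
  budget-claimII {A} {B} x∉A x∉B bound =
    <⇒≤ (<-≤-trans (unclaimed-decreases (∪-⊂ (λ y∈ → y∈) (q⊆p∪q _ B) (q⊆p∪q A _ (p⊆p∪q B (x∈⁅x⁆ _))) x∉A x∉B)) bound)

  budget-exhausted : ∀ {A B : Subset n} {x} → x ∉ A → x ∉ B → Budget A B 0 → ⊥
  budget-exhausted {A} {B} {x} x∉A x∉B bound =
    n≮0 (<-≤-trans (subst (_< ∣ ∁ (A ∪ B) ∣) (∣⊥∣≡0 n) (p⊂q⇒∣p∣<∣q∣ ∅⊂unclaimed)) bound)
    where
    ∅⊂unclaimed : ∅ ⊂ ∁ (A ∪ B)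
    ∅⊂unclaimed = (λ y∈∅ → ⊥-elim (∉⊥ y∈∅)) , x , x∉p⇒x∈∁p (λ x∈ → [ x∉A , x∉B ] (x∈p∪q⁻ A B x∈)) , ∉⊥

allSubsets : ∀ n → List (Subset n)
allSubsets zero = [] ∷ []
allSubsets (suc n) = map (true ∷_) (allSubsets n) ++ map (false ∷_) (allSubsets n)

allSubsets-complete : ∀ {n} (S : Subset n) → S ListMembership.∈ allSubsets n
allSubsets-complete [] = here refl
allSubsets-complete (true ∷ S) = ∈-++⁺ˡ (∈-map⁺ (true ∷_) (allSubsets-complete S))
allSubsets-complete (false ∷ S) = ∈-++⁺ʳ (map (true ∷_) (allSubsets _)) (∈-map⁺ (false ∷_) (allSubsets-complete S))

image-flip : ∀ {n} (π : Permutation′ n) (S : Subset n) → image π (image (flip π) S) ≡ S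
image-flip π S = trans (tabulate-cong (λ y → trans (lookup∘tabulate _ (π ⟨$⟩ˡ y)) (cong (lookup S) (inverseʳ π))))
                       (tabulate∘lookup S)

-- What a set contains of a two-point pair {(false, i), (true, i)}.
-- A pair has content empty, single s (only the point on side s) or full.
data Content : Set where
  empty : Content
  single : Bool → Content
  full : Content

contentOf : Bool → Bool → Content
contentOf false false = empty
contentOf true false = single false
contentOf false true = single true
contentOf true true = full

has : Content → Bool → Bool
has empty _ = false
has (single false) t = not t
has (single true) t = t
has full _ = true

has-contentOf : ∀ a₀ a₁ t → has (contentOf a₀ a₁) t ≡ (if t then a₁ else a₀)
has-contentOf false false false = refl
has-contentOf false false true = refl
has-contentOf true false false = refl
has-contentOf true false true = refl
has-contentOf false true false = refl
has-contentOf false true true = refl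
has-contentOf true true false = refl
has-contentOf true true true = refl

_≟ᶜ_ : DecidableEquality Content
empty ≟ᶜ empty = yes refl
empty ≟ᶜ single _ = no λ ()
empty ≟ᶜ full = no λ ()
single _ ≟ᶜ empty = no λ ()
single s ≟ᶜ single t with s ≟ᵇ t
... | yes refl = yes refl
... | no s≢t = no λ { refl → s≢t refl }
single _ ≟ᶜ full = no λ ()
full ≟ᶜ empty = no λ ()
full ≟ᶜ single _ = no λ ()
full ≟ᶜ full = yes refl

data Single : Content → Set where
  single : ∀ s → Single (single s)

single? : ∀ c → Dec (Single c)
single? empty = no λ ()
single? (single s) = yes (single s)
single? full = no λ ()

add : Bool → Content → Content
add t empty = single t
add _ (single _) = full
add _ full = full

data _⊑_ : Content → Content → Set where
  empty⊑ : ∀ {c} → empty ⊑ c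
  single⊑ : ∀ {s} → single s ⊑ single s
  ⊑full : ∀ {c} → c ⊑ full

contentOf-mono : ∀ {a₀ a₁ b₀ b₁} → (a₀ ≡ true → b₀ ≡ true) → (a₁ ≡ true → b₁ ≡ true) →
                 contentOf a₀ a₁ ⊑ contentOf b₀ b₁
contentOf-mono {false} {false} _ _ = empty⊑
contentOf-mono {b₀ = true} {true} _ _ = ⊑full
contentOf-mono {true} {false} {true} {false} _ _ = single⊑
contentOf-mono {false} {true} {false} {true} _ _ = single⊑
contentOf-mono {true} {b₀ = false} h₀ _ with h₀ refl
... | ()
contentOf-mono {a₁ = true} {b₁ = false} _ h₁ with h₁ refl
... | ()

relabel : Bool → Content → Content
relabel _ empty = empty
relabel δ (single s) = single (s xor δ)
relabel _ full = full

relabel-contentOf : ∀ δ a₀ a₁ → contentOf (if δ then a₁ else a₀) (if δ then a₀ else a₁) ≡ relabel δ (contentOf a₀ a₁)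
relabel-contentOf false false false = refl
relabel-contentOf false true false = refl
relabel-contentOf false false true = refl
relabel-contentOf false true true = refl
relabel-contentOf true false false = refl
relabel-contentOf true true false = refl
relabel-contentOf true false true = refl
relabel-contentOf true true true = refl

has-single-not : ∀ {c} δ → Single c → has c (not δ) ≡ has c true xor δ
has-single-not false (single false) = refl
has-single-not true (single false) = refl
has-single-not false (single true) = refl
has-single-not true (single true) = refl

module Game (m : ℕ) where

  open Tournament m public
  open Symmetry

  N : ℕ
  N = 2 * b

  opaque
    coordinates : Fin N ↔ (Bool × Fin b)
    coordinates = (2↔Bool ×-↔ ↔-id (Fin b)) ↔-∘ *↔×

  point : Bool → Fin b → Fin N
  point s i = Inverse.from coordinates (s , i)

  side : Fin N → Bool
  side x = proj₁ (Inverse.to coordinates x)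

  pair : Fin N → Fin b
  pair x = proj₂ (Inverse.to coordinates x)

  point-coordinates : ∀ x → point (side x) (pair x) ≡ x
  point-coordinates x = Inverse.strictlyInverseʳ coordinates x

  coordinates-point : ∀ s i → Inverse.to coordinates (point s i) ≡ (s , i)
  coordinates-point s i = Inverse.strictlyInverseˡ coordinates (s , i)

  side-point : ∀ s i → side (point s i) ≡ s
  side-point s i = cong proj₁ (coordinates-point s i)

  pair-point : ∀ s i → pair (point s i) ≡ i
  pair-point s i = cong proj₂ (coordinates-point s i)

  -- Subsets of the board are handled only through mem and content and the facts proved here.
  opaque
    mem : Subset N → Bool → Fin b → Bool
    mem S s i = lookup S (point s i)

    mem-∉ : ∀ {S t i} → mem S t i ≡ false → point t i ∉ S
    mem-∉ = false⇒∉

    ∉-mem : ∀ {S x} → x ∉ S → mem S (side x) (pair x) ≡ false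
    ∉-mem {S} {x} x∉S = trans (cong (lookup S) (point-coordinates x)) (∉⇒false x∉S)

    mem-claim-here : ∀ S t i → mem (⁅ point t i ⁆ ∪ S) t i ≡ true
    mem-claim-here S t i = lookup-add-here (point t i) S

    mem-claim-other-side : ∀ S t i → mem (⁅ point t i ⁆ ∪ S) (not t) i ≡ mem S (not t) i
    mem-claim-other-side S t i = lookup-add-elsewhere (point t i) (point (not t) i) S
      (λ eq → not-fixed t (trans (sym (side-point t i)) (trans (cong side eq) (side-point (not t) i))))
      where
      not-fixed : ∀ t → t ≢ not t
      not-fixed false ()
      not-fixed true ()

    mem-claim-elsewhere : ∀ S t i s j → i ≢ j → mem (⁅ point t i ⁆ ∪ S) s j ≡ mem S s j
    mem-claim-elsewhere S t i s j i≢j = lookup-add-elsewhere (point t i) (point s j) S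
      (λ eq → i≢j (trans (sym (pair-point t i)) (trans (cong pair eq) (pair-point s j))))

    mem-image : ∀ (π : Permutation′ N) S s i {s′ i′} → π ⟨$⟩ˡ point s i ≡ point s′ i′ → mem (image π S) s i ≡ mem S s′ i′
    mem-image π S s i moved = trans (lookup∘tabulate (λ y → lookup S (π ⟨$⟩ˡ y)) (point s i)) (cong (lookup S) moved)

    content : Subset N → Fin b → Content
    content S i = contentOf (mem S false i) (mem S true i)

    mem-content : ∀ S t i → mem S t i ≡ has (content S i) t
    mem-content S false i = sym (has-contentOf (mem S false i) (mem S true i) false)
    mem-content S true i = sym (has-contentOf (mem S false i) (mem S true i) true)

    content-∅ : ∀ i → content ∅ i ≡ empty
    content-∅ i rewrite lookup-replicate (point false i) false | lookup-replicate (point true i) false = refl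

    content-claim : ∀ S t i → mem S t i ≡ false → content (⁅ point t i ⁆ ∪ S) i ≡ add t (content S i)
    content-claim S false i free
      rewrite mem-claim-here S false i | mem-claim-other-side S false i | free with mem S true i
    ... | false = refl
    ... | true = refl
    content-claim S true i free
      rewrite mem-claim-here S true i | mem-claim-other-side S true i | free with mem S false i
    ... | false = refl
    ... | true = refl

    content-claim-elsewhere : ∀ S t i j → i ≢ j → content (⁅ point t i ⁆ ∪ S) j ≡ content S j
    content-claim-elsewhere S t i j i≢j =
      cong₂ contentOf (mem-claim-elsewhere S t i false j i≢j) (mem-claim-elsewhere S t i true j i≢j)

    content-mono : ∀ {ℓ S} → ℓ ⊆ S → ∀ i → content ℓ i ⊑ content S i
    content-mono {ℓ} {S} ℓ⊆S i = contentOf-mono (grow false) (grow true)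
      where
      grow : ∀ t → mem ℓ t i ≡ true → mem S t i ≡ true
      grow t ℓ∋ = []=⇒lookup (ℓ⊆S (lookup⇒[]= (point t i) ℓ ℓ∋))

    content-relabel : ∀ ℓ ℓ′ i j δ → (∀ s → mem ℓ′ s i ≡ mem ℓ (s xor δ) j) → content ℓ′ i ≡ relabel δ (content ℓ j)
    content-relabel ℓ ℓ′ i j false moved = trans (cong₂ contentOf (moved false) (moved true)) (relabel-contentOf false _ _)
    content-relabel ℓ ℓ′ i j true moved = trans (cong₂ contentOf (moved false) (moved true)) (relabel-contentOf true _ _)

  EvenTransversal : Subset N → Set
  EvenTransversal ℓ = (∀ i → Single (content ℓ i)) × parity (mem ℓ true) ≡ false

  TournamentLine : Subset N → Set
  TournamentLine ℓ = Σ (Fin b) λ f → Σ (Fin b) λ e →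
    beats e f × content ℓ f ≡ full × content ℓ e ≡ empty × (∀ i → i ≢ f → i ≢ e → Single (content ℓ i))

  IsLine : Subset N → Set
  IsLine ℓ = EvenTransversal ℓ ⊎ TournamentLine ℓ

  isLine? : ∀ ℓ → Dec (IsLine ℓ)
  isLine? ℓ = (all? (λ i → single? (content ℓ i)) ×-dec (parity (mem ℓ true) ≟ᵇ false)) ⊎-dec
    any? λ f → any? λ e → beats? e f ×-dec (content ℓ f ≟ᶜ full) ×-dec (content ℓ e ≟ᶜ empty) ×-dec
      all? λ i → ¬? (i ≟ f) →-dec ¬? (i ≟ e) →-dec single? (content ℓ i)

  lines : Lines N
  lines = filter isLine? (allSubsets N)

  line∈lines : ∀ {ℓ} → IsLine ℓ → ℓ ListMembership.∈ lines
  line∈lines {ℓ} line = ∈-filter⁺ isLine? (allSubsets-complete ℓ) line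

  lines-are-lines : ∀ {ℓ} → ℓ ListMembership.∈ lines → IsLine ℓ
  lines-are-lines ℓ∈ = proj₂ (∈-filter⁻ isLine? {xs = allSubsets N} ℓ∈)

  single-relabel : ∀ {c} δ → Single c → Single (relabel δ c)
  single-relabel δ (single s) = single (s xor δ)

  single-other-side : ∀ ℓ j δ → Single (content ℓ j) → mem ℓ (not δ) j ≡ mem ℓ true j xor δ
  single-other-side ℓ j δ one =
    trans (mem-content ℓ (not δ) j) (trans (has-single-not δ one) (cong (_xor δ) (sym (mem-content ℓ true j))))

  relabelled-line : (q : Permutation′ b) → (∀ {e f} → beats (q ⟨$⟩ʳ e) (q ⟨$⟩ʳ f) → beats e f) →
                    (d : Fin b → Bool) → parity d ≡ false → (ℓ ℓ′ : Subset N) →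
                    (∀ s i → mem ℓ′ s i ≡ mem ℓ (s xor d i) (q ⟨$⟩ʳ i)) → IsLine ℓ → IsLine ℓ′
  relabelled-line q reflect d even-d ℓ ℓ′ moved (inj₁ (transversal , even-ℓ)) = inj₁ (transversal′ , even-ℓ′)
    where
    contents : ∀ i → content ℓ′ i ≡ relabel (d i) (content ℓ (q ⟨$⟩ʳ i))
    contents i = content-relabel ℓ ℓ′ i (q ⟨$⟩ʳ i) (d i) (λ s → moved s i)
    transversal′ : ∀ i → Single (content ℓ′ i)
    transversal′ i = subst Single (sym (contents i)) (single-relabel (d i) (transversal (q ⟨$⟩ʳ i)))
    true-bits : ∀ i → mem ℓ′ true i ≡ mem ℓ true (q ⟨$⟩ʳ i) xor d i
    true-bits i = trans (moved true i) (single-other-side ℓ (q ⟨$⟩ʳ i) (d i) (transversal (q ⟨$⟩ʳ i)))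
    even-ℓ′ : parity (mem ℓ′ true) ≡ false
    even-ℓ′ = begin
      parity (mem ℓ′ true)                                ≡⟨ parity-cong true-bits ⟩
      parity (λ i → mem ℓ true (q ⟨$⟩ʳ i) xor d i)        ≡⟨ parity-xor (λ i → mem ℓ true (q ⟨$⟩ʳ i)) d ⟩
      parity (λ i → mem ℓ true (q ⟨$⟩ʳ i)) xor parity d   ≡⟨ cong₂ _xor_ (trans (parity-permute (mem ℓ true) q) even-ℓ) even-d ⟩
      false                                               ∎
      where open ≡-Reasoning
  relabelled-line q reflect d even-d ℓ ℓ′ moved (inj₂ (f , e , e→f , full-f , empty-e , singles)) =
    inj₂ (q ⟨$⟩ˡ f , q ⟨$⟩ˡ e , reflect (subst₂ beats (sym (inverseʳ q)) (sym (inverseʳ q)) e→f) ,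
          moved-content f full-f (λ _ → refl) , moved-content e empty-e (λ _ → refl) , singles′)
    where
    contents : ∀ i → content ℓ′ i ≡ relabel (d i) (content ℓ (q ⟨$⟩ʳ i))
    contents i = content-relabel ℓ ℓ′ i (q ⟨$⟩ʳ i) (d i) (λ s → moved s i)
    -- full and empty pairs are unaffected by relabelling sides
    moved-content : ∀ {c} i → content ℓ i ≡ c → (∀ δ → relabel δ c ≡ c) → content ℓ′ (q ⟨$⟩ˡ i) ≡ c
    moved-content i ℓ-i fixed =
      trans (contents (q ⟨$⟩ˡ i)) (trans (cong (relabel _) (trans (cong (content ℓ) (inverseʳ q)) ℓ-i)) (fixed _))
    singles′ : ∀ i → i ≢ q ⟨$⟩ˡ f → i ≢ q ⟨$⟩ˡ e → Single (content ℓ′ i)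
    singles′ i i≢f i≢e = subst Single (sym (contents i)) (single-relabel (d i)
      (singles (q ⟨$⟩ʳ i) (λ eq → i≢f (moved-back eq)) (λ eq → i≢e (moved-back eq))))
      where
      moved-back : ∀ {k} → q ⟨$⟩ʳ i ≡ k → i ≡ q ⟨$⟩ˡ k
      moved-back refl = sym (Permutation.inverseˡ q)

  module BoardMap (Q : Symmetry) (d : Fin b → Bool) where

    xor-cancel : ∀ a c → (a xor c) xor c ≡ a
    xor-cancel a c = trans (xor-assoc a c c) (trans (cong (a xor_) (xor-same c)) (xor-identityʳ a))

    forward : Fin N → Fin N
    forward x = point (side x xor d (pair x)) (perm Q ⟨$⟩ʳ pair x)

    backward : Fin N → Fin N
    backward y = point (side y xor d (perm Q ⟨$⟩ˡ pair y)) (perm Q ⟨$⟩ˡ pair y)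

    forward-point : ∀ s i → forward (point s i) ≡ point (s xor d i) (perm Q ⟨$⟩ʳ i)
    forward-point s i = cong₂ (λ u v → point (u xor d v) (perm Q ⟨$⟩ʳ v)) (side-point s i) (pair-point s i)

    backward-point : ∀ s i → backward (point s i) ≡ point (s xor d (perm Q ⟨$⟩ˡ i)) (perm Q ⟨$⟩ˡ i)
    backward-point s i = cong₂ (λ u v → point (u xor d (perm Q ⟨$⟩ˡ v)) (perm Q ⟨$⟩ˡ v)) (side-point s i) (pair-point s i)

    forward-backward : ∀ y → forward (backward y) ≡ y
    forward-backward y = trans (forward-point _ _)
      (trans (cong₂ point (xor-cancel (side y) _) (inverseʳ (perm Q))) (point-coordinates y))

    backward-forward : ∀ x → backward (forward x) ≡ x
    backward-forward x = trans (backward-point _ _)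
      (trans (cong₂ point (trans (cong (λ v → (side x xor d (pair x)) xor d v) back) (xor-cancel (side x) _)) back)
             (point-coordinates x))
      where
      back : perm Q ⟨$⟩ˡ (perm Q ⟨$⟩ʳ pair x) ≡ pair x
      back = Permutation.inverseˡ (perm Q)

    σ : Permutation′ N
    σ = permutation forward backward forward-backward backward-forward

    image-moves : ∀ ℓ s i → mem (image σ ℓ) s i ≡ mem ℓ (s xor d (perm Q ⟨$⟩ˡ i)) (perm Q ⟨$⟩ˡ i)
    image-moves ℓ s i = mem-image σ ℓ s i (backward-point s i)

    preimage-moves : ∀ ℓ s i → mem (image (flip σ) ℓ) s i ≡ mem ℓ (s xor d i) (perm Q ⟨$⟩ʳ i)
    preimage-moves ℓ s i = mem-image (flip σ) ℓ s i (forward-point s i)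

    automorphism : parity d ≡ false → IsAutomorphism lines σ
    automorphism even-d =
      (λ ℓ ℓ∈ → line∈lines (relabelled-line (perm (inverse Q)) (reflects (inverse Q)) (λ i → d (perm Q ⟨$⟩ˡ i))
                  (trans (parity-permute d (flip (perm Q))) even-d) ℓ (image σ ℓ) (image-moves ℓ) (lines-are-lines ℓ∈))) ,
      (λ ℓ ℓ∈ → image (flip σ) ℓ ,
                line∈lines (relabelled-line (perm Q) (reflects Q) d even-d ℓ (image (flip σ) ℓ) (preimage-moves ℓ)
                                            (lines-are-lines ℓ∈)) ,
                image-flip σ ℓ)

    sends : ∀ x y → perm Q ⟨$⟩ʳ pair x ≡ pair y → side x xor d (pair x) ≡ side y → σ ⟨$⟩ʳ x ≡ y
    sends x y pairs sides = trans (cong₂ point sides pairs) (point-coordinates y)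

  -- Flipping the sides of two distinct pairs i and j is an even flip that moves pair i.
  flip-two : Fin b → Fin b → Fin b → Bool
  flip-two i j k = indicator i k xor indicator j k

  flip-two-even : ∀ i j → parity (flip-two i j) ≡ false
  flip-two-even i j = trans (parity-xor (indicator i) (indicator j)) (cong₂ _xor_ (parity-indicator i) (parity-indicator j))

  flip-two-flips : ∀ i j → j ≢ i → flip-two i j i ≡ true
  flip-two-flips i j j≢i with i ≟ i | j ≟ i
  ... | yes _ | no _ = refl
  ... | no i≢i | _ = ⊥-elim (i≢i refl)
  ... | _ | yes j≡i = ⊥-elim (j≢i j≡i)

  transitive : (∀ i → Σ (Fin b) (λ j → j ≢ i)) → Transitive lines
  transitive other x y with symmetry-between (pair x) (pair y) | side x ≟ᵇ side y
  ... | Q , Q-x≡y | yes same-side =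
    BoardMap.σ Q (λ _ → false) , BoardMap.automorphism Q _ (parity-zero b) ,
    BoardMap.sends Q _ x y Q-x≡y (trans (xor-identityʳ (side x)) same-side)
  ... | Q , Q-x≡y | no other-side =
    BoardMap.σ Q d , BoardMap.automorphism Q d (flip-two-even (pair x) j) ,
    BoardMap.sends Q d x y Q-x≡y (trans (cong (side x xor_) (flip-two-flips (pair x) j j≢x)) (swap other-side))
    where
    j = proj₁ (other (pair x))
    j≢x = proj₂ (other (pair x))
    d = flip-two (pair x) j
    swap : ∀ {s t} → s ≢ t → s xor true ≡ t
    swap {false} {false} s≢t = ⊥-elim (s≢t refl)
    swap {false} {true} _ = refl
    swap {true} {false} _ = refl
    swap {true} {true} s≢t = ⊥-elim (s≢t refl)

  PairState : Set
  PairState = Content × Content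

  _≟ˢ_ : (p q : PairState) → Dec (p ≡ q)
  _≟ˢ_ = ≡-dec _≟ᶜ_ _≟ᶜ_

  state : Subset N → Subset N → Fin b → PairState
  state A B i = content A i , content B i

  free : PairState
  free = empty , empty

  split : Bool → PairState
  split s = single s , single (not s)

  -- Between the phases of Player I's strategy every pair is free or split.
  IsSettled : PairState → Set
  IsSettled p = p ≡ free ⊎ Σ Bool (λ s → p ≡ split s)

  Settled : Subset N → Subset N → Fin b → Set
  Settled A B i = IsSettled (state A B i)

  Unclaimed : Subset N → Subset N → Bool → Fin b → Set
  Unclaimed A B t j = mem A t j ≡ false × mem B t j ≡ false

  Open : Bool → PairState → Set
  Open t (a , c) = has a t ≡ false × has c t ≡ false

  unclaimed-open : ∀ {A B t j} → Unclaimed A B t j → Open t (state A B j)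
  unclaimed-open {A} {B} {t} {j} (a , c) = trans (sym (mem-content A t j)) a , trans (sym (mem-content B t j)) c

  open-unclaimed : ∀ {A B t j p} → state A B j ≡ p → Open t p → Unclaimed A B t j
  open-unclaimed {A} {B} {t} {j} refl (a , c) = trans (mem-content A t j) a , trans (mem-content B t j) c

  split-closed : ∀ {t} s → ¬ Open t (split s)
  split-closed {false} false (() , _)
  split-closed {true} false (_ , ())
  split-closed {false} true (_ , ())
  split-closed {true} true (() , _)

  settled-open : ∀ {p t} → IsSettled p → Open t p → p ≡ free
  settled-open (inj₁ p≡free) _ = p≡free
  settled-open (inj₂ (s , refl)) open-t = ⊥-elim (split-closed s open-t)

  half-open : ∀ {s t c} → Open t (single s , c) → t ≡ not s
  half-open {false} {true} _ = refl
  half-open {true} {false} _ = refl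
  half-open {false} {false} (() , _)
  half-open {true} {true} (() , _)

  claimI-here : ∀ {A B t j a c} → Unclaimed A B t j → state A B j ≡ (a , c) → state (⁅ point t j ⁆ ∪ A) B j ≡ (add t a , c)
  claimI-here {A} {B} {t} {j} (unclaimed-A , _) refl = cong (_, content B j) (content-claim A t j unclaimed-A)

  claimII-here : ∀ {A B t j a c} → Unclaimed A B t j → state A B j ≡ (a , c) → state A (⁅ point t j ⁆ ∪ B) j ≡ (a , add t c)
  claimII-here {A} {B} {t} {j} (_ , unclaimed-B) refl = cong (content A j ,_) (content-claim B t j unclaimed-B)

  claimI-elsewhere : ∀ (P : PairState → Set) {A B t j i} → j ≢ i → P (state A B i) → P (state (⁅ point t j ⁆ ∪ A) B i)
  claimI-elsewhere P {A} {B} {t} {j} {i} j≢i = subst P (cong (_, content B i) (sym (content-claim-elsewhere A t j i j≢i)))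

  claimII-elsewhere : ∀ (P : PairState → Set) {A B t j i} → j ≢ i → P (state A B i) → P (state A (⁅ point t j ⁆ ∪ B) i)
  claimII-elsewhere P {A} {B} {t} {j} {i} j≢i = subst P (cong (content A i ,_) (sym (content-claim-elsewhere B t j i j≢i)))

  single⋢empty : ∀ {c} → Single c → ¬ (c ⊑ empty)
  single⋢empty (single _) ()

  full⋢single : ∀ {c} → Single c → ¬ (full ⊑ c)
  full⋢single (single _) ()

  full⊑ : ∀ {c} → full ⊑ c → c ≡ full
  full⊑ ⊑full = refl

  single⊑single : ∀ {c c′} → Single c → Single c′ → c ⊑ c′ → c ≡ c′
  single⊑single _ _ single⊑ = refl
  single⊑single (single _) () ⊑full

  -- If A misses pair r entirely and every pair filled by A beats r, then A contains no line:
  -- a line meets r unless it is a tournament line avoiding e = r, whose full pair f would then beat r.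
  no-line-around : ∀ {A} r → content A r ≡ empty → (∀ f → content A f ≡ full → beats f r) → ¬ CompletesLine lines A
  no-line-around {A} r hole filled→r (ℓ , ℓ∈ , ℓ⊆A) with lines-are-lines ℓ∈
  ... | inj₁ (transversal , _) = misses-hole (transversal r)
    where
    misses-hole : ¬ Single (content ℓ r)
    misses-hole one = single⋢empty one (subst (content ℓ r ⊑_) hole (content-mono ℓ⊆A r))
  ... | inj₂ (f , e , e→f , full-f , _ , singles) = avoid (r ≟ f) (r ≟ e)
    where
    f→r : beats f r
    f→r = filled→r f (full⊑ (subst (_⊑ content A f) full-f (content-mono ℓ⊆A f)))
    avoid : Dec (r ≡ f) → Dec (r ≡ e) → ⊥
    avoid (yes r≡f) _ = beats-irrefl (subst (beats f) r≡f f→r)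
    avoid (no _) (yes r≡e) = beats-asym e→f (subst (beats f) r≡e f→r)
    avoid (no r≢f) (no r≢e) = single⋢empty (singles r r≢f r≢e) (subst (content ℓ r ⊑_) hole (content-mono ℓ⊆A r))

  -- A transversal of odd parity contains no line: a line inside it would be the transversal itself.
  no-line-in-odd-transversal : ∀ {A} → (∀ i → Single (content A i)) → parity (mem A true) ≡ true → ¬ CompletesLine lines A
  no-line-in-odd-transversal {A} singles odd (ℓ , ℓ∈ , ℓ⊆A) with lines-are-lines ℓ∈
  ... | inj₁ (transversal , even) = false≢true (trans (sym even) (trans (parity-cong same-sides) odd))
    where
    false≢true : false ≢ true
    false≢true ()
    same-sides : ∀ i → mem ℓ true i ≡ mem A true i
    same-sides i = trans (mem-content ℓ true i) (trans (cong (λ c → has c true)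
      (single⊑single (transversal i) (singles i) (content-mono ℓ⊆A i))) (sym (mem-content A true i)))
  ... | inj₂ (f , _ , _ , full-f , _) = full⋢single (singles f) (subst (_⊑ content A f) full-f (content-mono ℓ⊆A f))

  line-completes : ∀ {B} → IsLine B → CompletesLine lines B
  line-completes {B} line = B , line∈lines line , λ x∈ → x∈

  budgetI : ∀ {A B t j k} → Unclaimed A B t j → Budget A B (suc k) → Budget (⁅ point t j ⁆ ∪ A) B k
  budgetI (a , c) = budget-claimI (mem-∉ a) (mem-∉ c)

  budgetII : ∀ {A B t j k} → Unclaimed A B t j → Budget A B k → Budget A (⁅ point t j ⁆ ∪ B) k
  budgetII (a , c) = budget-claimII (mem-∉ a) (mem-∉ c)

  -- Some unclaimed point remains as long as the phase invariants hold, so the budget is never 0.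
  exhausted : ∀ {A B t j} → Unclaimed A B t j → ¬ Budget A B 0
  exhausted (a , c) = budget-exhausted (mem-∉ a) (mem-∉ c)

  claimI : ∀ {A B} t j → Unclaimed A B t j → ¬ CompletesLine lines (⁅ point t j ⁆ ∪ A) →
           WinI-IIToMove lines (⁅ point t j ⁆ ∪ A) B → WinI-toMove lines A B
  claimI t j (a , c) no-line next = move (point t j) (mem-∉ a) (mem-∉ c) no-line next

  Answer : Subset N → Subset N → Bool → Fin b → Set
  Answer A B t j = CompletesLine lines (⁅ point t j ⁆ ∪ B) ⊎ WinI-toMove lines A (⁅ point t j ⁆ ∪ B)

  answerII : ∀ {A B} s i → Unclaimed A B s i → (∀ t j → Unclaimed A B t j → Answer A B t j) → WinI-IIToMove lines A B
  answerII {A} {B} s i (a , c) answer = replies (point s i , mem-∉ a , mem-∉ c) λ y y∉A y∉B →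
    subst (λ z → CompletesLine lines (⁅ z ⁆ ∪ B) ⊎ WinI-toMove lines A (⁅ z ⁆ ∪ B)) (point-coordinates y)
      (answer (side y) (pair y) (∉-mem y∉A , ∉-mem y∉B))

  free-unclaimed : ∀ {A B j t} → state A B j ≡ free → Unclaimed A B t j
  free-unclaimed j-free = open-unclaimed j-free (refl , refl)

  has-single-other : ∀ s → has (single s) (not s) ≡ false
  has-single-other false = refl
  has-single-other true = refl

  filledI-elsewhere : ∀ {A B t j i} → Unclaimed A B t j → state A B i ≡ (full , empty) → j ≢ i
  filledI-elsewhere {t = t} claim i-full refl with subst (Open t) i-full (unclaimed-open claim)
  ... | () , _

  filledII-elsewhere : ∀ {A B t j i} → Unclaimed A B t j → state A B i ≡ (empty , full) → j ≢ i
  filledII-elsewhere {t = t} claim i-full refl with subst (Open t) i-full (unclaimed-open claim)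
  ... | _ , ()

  settled-not-full : ∀ {p} → IsSettled p → proj₁ p ≢ full
  settled-not-full (inj₁ refl) ()
  settled-not-full (inj₂ (_ , refl)) ()

  filled-beat : ∀ {A} h r → (content A h ≡ full → beats h r) → (∀ i → i ≢ h → content A i ≢ full) →
                ∀ f → content A f ≡ full → beats f r
  filled-beat h r h-ok others f full-f with f ≟ h
  ... | yes refl = h-ok full-f
  ... | no f≢h = ⊥-elim (others f f≢h full-f)

  closes-half : ∀ {A B t h s} → Unclaimed A B t h → state A B h ≡ (single s , empty) → state A (⁅ point t h ⁆ ∪ B) h ≡ split s
  closes-half {t = t} {s = s} claim h-half = trans (claimII-here claim h-half)
    (cong (λ u → single s , single u) (half-open {c = empty} (subst (Open t) h-half (unclaimed-open claim))))

  mirror-unclaimed : ∀ {A B t j} → state A B j ≡ free → Unclaimed A (⁅ point t j ⁆ ∪ B) (not t) j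
  mirror-unclaimed {t = t} j-free = open-unclaimed (claimII-here (free-unclaimed j-free) j-free) (refl , has-single-other t)

  mirror-split : ∀ {A B t j} → state A B j ≡ free → Settled (⁅ point (not t) j ⁆ ∪ A) (⁅ point t j ⁆ ∪ B) j
  mirror-split {t = t} j-free = inj₂ (not t , trans (claimI-here (mirror-unclaimed j-free) (claimII-here (free-unclaimed j-free) j-free))
    (cong (λ u → single (not t) , single u) (sym (not-involutive t))))

  split-sides : ∀ {A B i s} → state A B i ≡ split s → mem B true i ≡ not (mem A true i)
  split-sides {A} {B} {i} {s} i-split = trans (mem-content B true i)
    (trans (cong (λ c → has c true) (cong proj₂ i-split))
    (trans (complement s) (cong not (trans (cong (λ c → has c true) (sym (cong proj₁ i-split))) (sym (mem-content A true i))))))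
    where
    complement : ∀ s → has (single (not s)) true ≡ not (has (single s) true)
    complement false = refl
    complement true = refl

  claim-parity : ∀ A s x → mem A true x ≡ false → parity (mem (⁅ point s x ⁆ ∪ A) true) ≡ s xor parity (mem A true)
  claim-parity A s x unclaimed =
    trans (parity-set (mem A true) (mem (⁅ point s x ⁆ ∪ A) true) x unclaimed
                      (λ i i≢x → mem-claim-elsewhere A s x true i (≢-sym i≢x)))
          (cong (_xor parity (mem A true)) (true-bit s))
    where
    true-bit : ∀ s → mem (⁅ point s x ⁆ ∪ A) true x ≡ s
    true-bit false = trans (mem-claim-other-side A false x) unclaimed
    true-bit true = mem-claim-here A true x

  -- When every pair is split, Player II holds the transversal complementary to Player I's; as the
  -- number b of pairs is odd, it is a line if Player I's transversal is odd.
  all-split-line : ∀ {A B} → (∀ i → Σ Bool λ s → state A B i ≡ split s) → parity (mem A true) ≡ true → IsLine B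
  all-split-line {A} {B} splits odd = inj₁ (singles , even)
    where
    singles : ∀ i → Single (content B i)
    singles i = subst Single (sym (cong proj₂ (proj₂ (splits i)))) (single (not (proj₁ (splits i))))
    even : parity (mem B true) ≡ false
    even = begin
      parity (mem B true)                 ≡⟨ parity-cong (λ i → split-sides (proj₂ (splits i))) ⟩
      parity (λ i → not (mem A true i))   ≡⟨ parity-complement m (mem A true) ⟩
      not (parity (mem A true))           ≡⟨ cong not odd ⟩
      false                               ∎
      where open ≡-Reasoning

  -- The four phases of Player I's strategy are invariants of the position.
  -- Phase 0 (Player I to move): every pair is settled and pair x is free.
  record Quiet (A B : Subset N) : Set where
    field
      x : Fin b
      x-free : state A B x ≡ free
      settled : ∀ i → Settled A B i

  -- Phase 1 (Player II to move): Player I holds side s of pair h, h beats the free pair r,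
  -- and every pair other than h is settled.
  record Opened (A B : Subset N) : Set where
    field
      h r : Fin b
      s : Bool
      h-half : state A B h ≡ (single s , empty)
      h→r : beats h r
      r-free : state A B r ≡ free
      settled : ∀ i → i ≢ h → Settled A B i

  -- Pending A B r o: either Player II holds one point of pair r = o, or Player II holds all of r and
  -- Player I one point of o.  Either way Player I holds nothing of r, and o has an unclaimed point.
  Pending : Subset N → Subset N → Fin b → Fin b → Set
  Pending A B r o = (o ≡ r × Σ Bool λ s → state A B r ≡ (empty , single s))
                  ⊎ (state A B r ≡ (empty , full) × Σ Bool λ s → state A B o ≡ (single s , empty))

  -- Phase 2 (Player II to move): Player I has filled pair h, h beats r, r and o are as in Pending,
  -- and every other pair is settled.
  record Filled (A B : Subset N) : Set where
    field
      h r o : Fin b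
      h-full : state A B h ≡ (full , empty)
      h→r : beats h r
      pending : Pending A B r o
      settled : ∀ i → i ≢ h → i ≢ r → i ≢ o → Settled A B i

  -- Phase 3 (Player I to move): Player I has filled h, Player II has filled r, h beats r, and
  -- every other pair is settled.
  record Decided (A B : Subset N) : Set where
    field
      h r : Fin b
      h-full : state A B h ≡ (full , empty)
      r-full : state A B r ≡ (empty , full)
      h→r : beats h r
      settled : ∀ i → i ≢ h → i ≢ r → Settled A B i

  pending-hole : ∀ {A B r o} → Pending A B r o → content A r ≡ empty
  pending-hole (inj₁ (_ , _ , r-half)) = cong proj₁ r-half
  pending-hole (inj₂ (r-full , _)) = cong proj₁ r-full

  pending-not-full : ∀ {A B r o} → Pending A B r o → content A o ≢ full
  pending-not-full (inj₁ (refl , _ , r-half)) full-o with trans (sym (cong proj₁ r-half)) full-o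
  ... | ()
  pending-not-full (inj₂ (_ , _ , o-half)) full-o with trans (sym (cong proj₁ o-half)) full-o
  ... | ()

  pending-open : ∀ {A B r o} → Pending A B r o → Σ Bool λ t → Unclaimed A B t o
  pending-open (inj₁ (refl , s , r-half)) = not s , open-unclaimed r-half (refl , has-single-other s)
  pending-open (inj₂ (_ , s , o-half)) = not s , open-unclaimed o-half (has-single-other s , refl)

  pending-closed : ∀ {A B r o t} → Pending A B r o → Unclaimed A B t r → r ≡ o
  pending-closed (inj₁ (o≡r , _)) _ = sym o≡r
  pending-closed (inj₂ (r-full , _)) claim = ⊥-elim (filledII-elsewhere claim r-full refl)

  pending-claimI : ∀ {A B r o t j} → j ≢ r → j ≢ o → Pending A B r o → Pending (⁅ point t j ⁆ ∪ A) B r o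
  pending-claimI j≢r _ (inj₁ (o≡r , s , r-half)) = inj₁ (o≡r , s , claimI-elsewhere (_≡ (empty , single s)) j≢r r-half)
  pending-claimI j≢r j≢o (inj₂ (r-full , s , o-half)) =
    inj₂ (claimI-elsewhere (_≡ (empty , full)) j≢r r-full , s , claimI-elsewhere (_≡ (single s , empty)) j≢o o-half)

  pending-claimII : ∀ {A B r o t j} → j ≢ r → j ≢ o → Pending A B r o → Pending A (⁅ point t j ⁆ ∪ B) r o
  pending-claimII j≢r _ (inj₁ (o≡r , s , r-half)) = inj₁ (o≡r , s , claimII-elsewhere (_≡ (empty , single s)) j≢r r-half)
  pending-claimII j≢r j≢o (inj₂ (r-full , s , o-half)) =
    inj₂ (claimII-elsewhere (_≡ (empty , full)) j≢r r-full , s , claimII-elsewhere (_≡ (single s , empty)) j≢o o-half)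

  -- In phases 1 and 2 Player I's set contains no line: he holds nothing of r, and fills at most h, which beats r.
  opened-no-line : ∀ {A B} → Opened A B → ¬ CompletesLine lines A
  opened-no-line inv = no-line-around r (cong proj₁ r-free) (filled-beat h r h-not-full (λ i i≢h → settled-not-full (settled i i≢h)))
    where
    open Opened inv
    h-not-full : _ ≡ full → beats h r
    h-not-full full-h with trans (sym (cong proj₁ h-half)) full-h
    ... | ()

  filled-no-line : ∀ {A B} → Filled A B → ¬ CompletesLine lines A
  filled-no-line {A} inv = no-line-around r (pending-hole pending) (filled-beat h r (λ _ → h→r) others)
    where
    open Filled inv
    others : ∀ i → i ≢ h → content A i ≢ full
    others i i≢h with i ≟ r | i ≟ o
    ... | yes refl | _ = λ full-r → case-empty (trans (sym (pending-hole pending)) full-r)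
      where
      case-empty : empty ≢ full
      case-empty ()
    ... | no _ | yes refl = pending-not-full pending
    ... | no i≢r | no i≢o = settled-not-full (settled i i≢h i≢r i≢o)

  MoveInto : (Subset N → Subset N → Set) → Subset N → Subset N → Set
  MoveInto P A B = Σ Bool λ t → Σ (Fin b) λ j → Unclaimed A B t j × P (⁅ point t j ⁆ ∪ A) B

  h≢r-of : ∀ {h r} → beats h r → h ≢ r
  h≢r-of h→r refl = beats-irrefl h→r

  -- Phase 0 → 1: Player I claims a point of a free pair h that beats another free pair r.
  open-pair : ∀ {A B h r} → (∀ i → Settled A B i) → beats h r → state A B h ≡ free → state A B r ≡ free → MoveInto Opened A B
  open-pair {A} {B} {h} {r} settled h→r h-free r-free = false , h , claim , record
    { h = h ; r = r ; s = false
    ; h-half = claimI-here claim h-free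
    ; h→r = h→r
    ; r-free = claimI-elsewhere (_≡ free) (h≢r-of h→r) r-free
    ; settled = λ i i≢h → claimI-elsewhere IsSettled (≢-sym i≢h) (settled i) }
    where
    claim : Unclaimed A B false h
    claim = free-unclaimed h-free

  opening : ∀ {A B} (q : Quiet A B) → ∀ y → y ≢ Quiet.x q → state A B y ≡ free → MoveInto Opened A B
  opening q y y≢x y-free with beats-total (Quiet.x q) y (≢-sym y≢x)
  ... | inj₁ x→y = open-pair (Quiet.settled q) x→y (Quiet.x-free q) y-free
  ... | inj₂ y→x = open-pair (Quiet.settled q) y→x y-free (Quiet.x-free q)

  -- Phase 1 → 0: Player II claims the other point of h, which becomes split.
  half-closed : ∀ {A B t} (inv : Opened A B) → Unclaimed A B t (Opened.h inv) → Quiet A (⁅ point t (Opened.h inv) ⁆ ∪ B)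
  half-closed inv claim = record
    { x = r
    ; x-free = claimII-elsewhere (_≡ free) (h≢r-of h→r) r-free
    ; settled = settled′ }
    where
    open Opened inv
    settled′ : ∀ i → Settled _ _ i
    settled′ i with i ≟ h
    ... | yes refl = inj₂ (s , closes-half claim h-half)
    ... | no i≢h = claimII-elsewhere IsSettled (≢-sym i≢h) (settled i i≢h)

  -- Phase 1 → 2: Player II claims a point of a free pair j beaten by h; Player I fills h.
  fill-half : ∀ {A B t j} (inv : Opened A B) → Unclaimed A B t j → j ≢ Opened.h inv → beats (Opened.h inv) j →
              MoveInto Filled A (⁅ point t j ⁆ ∪ B)
  fill-half {A} {B} {t} {j} inv claim j≢h h→j = not s , h , fill , record
    { h = h ; r = j ; o = j
    ; h-full = claimI-here fill h-half′
    ; h→r = h→j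
    ; pending = inj₁ (refl , t , claimI-elsewhere (_≡ (empty , single t)) (≢-sym j≢h) (claimII-here claim j-free))
    ; settled = λ i i≢h i≢j _ → claimI-elsewhere IsSettled (≢-sym i≢h) (claimII-elsewhere IsSettled (≢-sym i≢j) (settled i i≢h)) }
    where
    open Opened inv
    j-free : state A B j ≡ free
    j-free = settled-open (settled j j≢h) (unclaimed-open claim)
    h-half′ : state A (⁅ point t j ⁆ ∪ B) h ≡ (single s , empty)
    h-half′ = claimII-elsewhere (_≡ (single s , empty)) j≢h h-half
    fill : Unclaimed A (⁅ point t j ⁆ ∪ B) (not s) h
    fill = open-unclaimed h-half′ (has-single-other s , refl)

  -- Phase 1 → 1: Player II claims a point of a free pair j not beaten by h; Player I takes the other point.
  mirror-opened : ∀ {A B t j} (inv : Opened A B) → Unclaimed A B t j → j ≢ Opened.h inv → ¬ beats (Opened.h inv) j →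
                  MoveInto Opened A (⁅ point t j ⁆ ∪ B)
  mirror-opened {A} {B} {t} {j} inv claim j≢h h↛j = not t , j , mirror-unclaimed j-free , record
    { h = h ; r = r ; s = s
    ; h-half = claimI-elsewhere (_≡ (single s , empty)) j≢h (claimII-elsewhere (_≡ (single s , empty)) j≢h h-half)
    ; h→r = h→r
    ; r-free = claimI-elsewhere (_≡ free) j≢r (claimII-elsewhere (_≡ free) j≢r r-free)
    ; settled = settled′ }
    where
    open Opened inv
    j-free : state A B j ≡ free
    j-free = settled-open (settled j j≢h) (unclaimed-open claim)
    j≢r : j ≢ r
    j≢r refl = h↛j h→r
    settled′ : ∀ i → i ≢ h → Settled (⁅ point (not t) j ⁆ ∪ A) (⁅ point t j ⁆ ∪ B) i
    settled′ i i≢h with i ≟ j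
    ... | yes refl = mirror-split j-free
    ... | no i≢j = claimI-elsewhere IsSettled (≢-sym i≢j) (claimII-elsewhere IsSettled (≢-sym i≢j) (settled i i≢h))

  -- Phase 2 → 3: Player II claims the unclaimed point of o; thereby Player II fills r.
  resolve : ∀ {A B t} (inv : Filled A B) → Unclaimed A B t (Filled.o inv) → Decided A (⁅ point t (Filled.o inv) ⁆ ∪ B)
  resolve {A} {B} {t} inv claim = record
    { h = h ; r = r
    ; h-full = claimII-elsewhere (_≡ (full , empty)) (filledI-elsewhere claim h-full) h-full
    ; r-full = r-full′ pending
    ; h→r = h→r
    ; settled = settled′ pending }
    where
    open Filled inv
    B′ = ⁅ point t o ⁆ ∪ B
    r-full′ : Pending A B r o → state A B′ r ≡ (empty , full)
    r-full′ (inj₁ (refl , _ , r-half)) = claimII-here claim r-half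
    r-full′ (inj₂ (r-full , _)) = claimII-elsewhere (_≡ (empty , full)) (filledII-elsewhere claim r-full) r-full
    settled′ : Pending A B r o → ∀ i → i ≢ h → i ≢ r → Settled A B′ i
    settled′ (inj₁ (refl , _)) i i≢h i≢r = claimII-elsewhere IsSettled (≢-sym i≢r) (settled i i≢h i≢r i≢r)
    settled′ (inj₂ (_ , _ , o-half)) i i≢h i≢r with i ≟ o
    ... | yes refl = inj₂ (_ , closes-half claim o-half)
    ... | no i≢o = claimII-elsewhere IsSettled (≢-sym i≢o) (settled i i≢h i≢r i≢o)

  -- Phase 2 → 2: Player II claims a point of any pair j other than o, necessarily free; Player I takes the other point.
  mirror-filled : ∀ {A B t j} (inv : Filled A B) → Unclaimed A B t j → j ≢ Filled.o inv → MoveInto Filled A (⁅ point t j ⁆ ∪ B)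
  mirror-filled {A} {B} {t} {j} inv claim j≢o = not t , j , mirror-unclaimed j-free , record
    { h = h ; r = r ; o = o
    ; h-full = claimI-elsewhere (_≡ (full , empty)) j≢h (claimII-elsewhere (_≡ (full , empty)) j≢h h-full)
    ; h→r = h→r
    ; pending = pending-claimI j≢r j≢o (pending-claimII j≢r j≢o pending)
    ; settled = settled′ }
    where
    open Filled inv
    j≢h : j ≢ h
    j≢h = filledI-elsewhere claim h-full
    j≢r : j ≢ r
    j≢r refl = j≢o (pending-closed pending claim)
    j-free : state A B j ≡ free
    j-free = settled-open (settled j j≢h j≢r j≢o) (unclaimed-open claim)
    settled′ : ∀ i → i ≢ h → i ≢ r → i ≢ o → Settled (⁅ point (not t) j ⁆ ∪ A) (⁅ point t j ⁆ ∪ B) i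
    settled′ i i≢h i≢r i≢o with i ≟ j
    ... | yes refl = mirror-split j-free
    ... | no i≢j = claimI-elsewhere IsSettled (≢-sym i≢j) (claimII-elsewhere IsSettled (≢-sym i≢j) (settled i i≢h i≢r i≢o))

  -- Phase 3 → 2: Player I claims a point of a free pair x, which becomes the new pair o.
  reopen : ∀ {A B x} (inv : Decided A B) → state A B x ≡ free → MoveInto Filled A B
  reopen {A} {B} {x} inv x-free = false , x , claim , record
    { h = h ; r = r ; o = x
    ; h-full = claimI-elsewhere (_≡ (full , empty)) x≢h h-full
    ; h→r = h→r
    ; pending = inj₂ (claimI-elsewhere (_≡ (empty , full)) x≢r r-full , false , claimI-here claim x-free)
    ; settled = λ i i≢h i≢r i≢x → claimI-elsewhere IsSettled (≢-sym i≢x) (settled i i≢h i≢r) }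
    where
    open Decided inv
    claim : Unclaimed A B false x
    claim = free-unclaimed x-free
    x≢h : x ≢ h
    x≢h = filledI-elsewhere claim h-full
    x≢r : x ≢ r
    x≢r = filledII-elsewhere claim r-full

  -- Phase 3 with no free pair left: Player II's set is a tournament line (nothing of h, all of r, h beats r).
  decided-line : ∀ {A B} (inv : Decided A B) → ¬ (Σ (Fin b) λ x → state A B x ≡ free) → IsLine B
  decided-line {A} {B} inv no-free = inj₂ (r , h , h→r , cong proj₂ r-full , cong proj₂ h-full , singles)
    where
    open Decided inv
    singles : ∀ i → i ≢ r → i ≢ h → Single (content B i)
    singles i i≢r i≢h with settled i i≢h i≢r
    ... | inj₁ i-free = ⊥-elim (no-free (i , i-free))
    ... | inj₂ (s , i-split) = subst Single (sym (cong proj₂ i-split)) (single (not s))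

  -- Endgame of phase 0, when x is the only free pair: Player I claims the side of x that makes his
  -- transversal odd.  Player II must take the other side of x, completing the complementary transversal,
  -- which is even because the number b of pairs is odd.
  last-pair : ∀ {A B} (q : Quiet A B) → ¬ (Σ (Fin b) λ y → y ≢ Quiet.x q × state A B y ≡ free) → WinI-toMove lines A B
  last-pair {A} {B} q no-other = claimI s x claim (no-line-in-odd-transversal singles odd) (answerII (not s) x other-side answer)
    where
    open Quiet q
    s = not (parity (mem A true))
    claim : Unclaimed A B s x
    claim = free-unclaimed x-free
    A′ = ⁅ point s x ⁆ ∪ A
    x-half : state A′ B x ≡ (single s , empty)
    x-half = claimI-here claim x-free
    splits : ∀ i → i ≢ x → Σ Bool λ s′ → state A′ B i ≡ split s′
    splits i i≢x with settled i
    ... | inj₁ i-free = ⊥-elim (no-other (i , i≢x , i-free))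
    ... | inj₂ (s′ , i-split) = s′ , claimI-elsewhere (_≡ split s′) (≢-sym i≢x) i-split
    singles : ∀ i → Single (content A′ i)
    singles i with i ≟ x
    ... | yes refl = subst Single (sym (cong proj₁ x-half)) (single s)
    ... | no i≢x with splits i i≢x
    ...   | s′ , i-split = subst Single (sym (cong proj₁ i-split)) (single s′)
    odd : parity (mem A′ true) ≡ true
    odd = trans (claim-parity A s x (proj₁ (free-unclaimed {t = true} x-free))) (xor-inverseˡ (parity (mem A true)))
    other-side : Unclaimed A′ B (not s) x
    other-side = open-unclaimed x-half (has-single-other s , refl)
    -- Player II can only claim the other side of x, and then every pair is split.
    answer : ∀ t j → Unclaimed A′ B t j → Answer A′ B t j
    answer t j claim′ with j ≟ x
    ... | no j≢x = ⊥-elim (split-closed (proj₁ (splits j j≢x)) (subst (Open t) (proj₂ (splits j j≢x)) (unclaimed-open claim′)))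
    ... | yes refl = inj₁ (line-completes (all-split-line all-split odd))
      where
      all-split : ∀ i → Σ Bool λ s′ → state A′ (⁅ point t x ⁆ ∪ B) i ≡ split s′
      all-split i with i ≟ x
      ... | yes refl = s , closes-half claim′ x-half
      ... | no i≢x with splits i i≢x
      ...   | s′ , i-split = s′ , claimII-elsewhere (_≡ split s′) (≢-sym i≢x) i-split

  -- Player I's strategy, by recursion on an upper bound k for the number of unclaimed points,
  -- which every move of Player I lowers.
  mutual
    move-into-opened : ∀ k A B → Budget A B k → MoveInto Opened A B → WinI-toMove lines A B
    move-into-opened zero A B budget (_ , _ , claim , _) = ⊥-elim (exhausted claim budget)
    move-into-opened (suc k) A B budget (t , j , claim , inv) =
      claimI t j claim (opened-no-line inv) (opened k _ B (budgetI claim budget) inv)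

    move-into-filled : ∀ k A B → Budget A B k → MoveInto Filled A B → WinI-toMove lines A B
    move-into-filled zero A B budget (_ , _ , claim , _) = ⊥-elim (exhausted claim budget)
    move-into-filled (suc k) A B budget (t , j , claim , inv) =
      claimI t j claim (filled-no-line inv) (filled k _ B (budgetI claim budget) inv)

    quiet : ∀ k A B → Budget A B k → Quiet A B → WinI-toMove lines A B
    quiet k A B budget q with any? (λ y → ¬? (y ≟ Quiet.x q) ×-dec (state A B y ≟ˢ free))
    ... | yes (y , y≢x , y-free) = move-into-opened k A B budget (opening q y y≢x y-free)
    ... | no no-other = last-pair q no-other

    opened : ∀ k A B → Budget A B k → Opened A B → WinI-IIToMove lines A B
    opened k A B budget inv = answerII false (Opened.r inv) (free-unclaimed (Opened.r-free inv)) (opened-reply k A B budget inv)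

    opened-reply : ∀ k A B → Budget A B k → (inv : Opened A B) → ∀ t j → Unclaimed A B t j → Answer A B t j
    opened-reply k A B budget inv t j claim with j ≟ Opened.h inv
    ... | yes refl = inj₂ (quiet k A _ (budgetII claim budget) (half-closed inv claim))
    ... | no j≢h with beats? (Opened.h inv) j
    ...   | yes h→j = inj₂ (move-into-filled k A _ (budgetII claim budget) (fill-half inv claim j≢h h→j))
    ...   | no h↛j = inj₂ (move-into-opened k A _ (budgetII claim budget) (mirror-opened inv claim j≢h h↛j))

    filled : ∀ k A B → Budget A B k → Filled A B → WinI-IIToMove lines A B
    filled k A B budget inv = answerII _ (Filled.o inv) (proj₂ (pending-open (Filled.pending inv))) (filled-reply k A B budget inv)

    filled-reply : ∀ k A B → Budget A B k → (inv : Filled A B) → ∀ t j → Unclaimed A B t j → Answer A B t j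
    filled-reply k A B budget inv t j claim with j ≟ Filled.o inv
    ... | yes refl = decided k A _ (budgetII claim budget) (resolve inv claim)
    ... | no j≢o = inj₂ (move-into-filled k A _ (budgetII claim budget) (mirror-filled inv claim j≢o))

    decided : ∀ k A B → Budget A B k → Decided A B → CompletesLine lines B ⊎ WinI-toMove lines A B
    decided k A B budget inv with any? (λ x → state A B x ≟ˢ free)
    ... | yes (x , x-free) = inj₂ (move-into-filled k A B budget (reopen inv x-free))
    ... | no no-free = inj₁ (line-completes (decided-line inv no-free))

  player-I-wins : PlayerIWin lines
  player-I-wins = quiet _ ∅ ∅ ≤-refl record { x = zero ; x-free = empty-free zero ; settled = λ i → inj₁ (empty-free i) }
    where
    empty-free : ∀ i → state ∅ ∅ i ≡ free
    empty-free i = cong (λ c → c , c) (content-∅ i)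

odd-half : ∀ n → n % 2 ≡ 1 → Σ ℕ λ q → n ≡ suc (q + q)
odd-half (suc zero) _ = zero , refl
odd-half (suc (suc n)) odd with odd-half n odd
... | q , refl = suc q , cong (λ k → suc (suc k)) (sym (+-suc q q))

-- Write b = 2(m+1)+1 (b = 1 is excluded by b ≥ 3) and take the game of Game (m+1); it has at least
-- two pairs, so the rotation moves every pair.
proposition10 : (b : ℕ) → b % 2 ≡ 1 → 3 ≤ b →
    Σ (Lines (2 * b)) (λ ℒ → Transitive ℒ × PlayerIWin ℒ)
proposition10 b odd 3≤b with odd-half b odd
... | zero , refl with 3≤b
...   | s≤s ()
proposition10 b odd 3≤b | suc m , refl = lines , transitive (λ i → rotate i , rotate-moves i) , player-I-wins
  where open Game (suc m)
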